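{- The update operator $\oplus_2$ satisfies, for all extended logic programs $P,P_1,P_2$ and every rule $x$: (BK-1) $P\oplus_2\{x\}$ is a program; (BK-2) $P_1\oplus_2P_2\vdash_{N_2}P_2$; (BK-3) $P_1\cup P_2\vdash_{N_2}P_1\oplus_2P_2$; (BK-5) if $P_2\equiv_{N_2}\bot$ then $P_1\oplus_2P_2\equiv_{N_2}\bot$; (BK-6) if $P_1\equiv_{N_2}P_2$ then $P\oplus_2P_1$ and $P\oplus_2P_2$ have the same answer sets.
   Context: Formulas use $\wedge,\vee,\rightarrow,\bot$ and strong negation $\sim$; $\lnot F$ is $F\rightarrow\bot$, $\top$ is $\bot\rightarrow\bot$. A literal is an atom $a$ or $\sim a$; $\sim L$ denotes the complementary literal ($\sim\sim a=a$). An extended logic program (ELP) is a finite set of rules $r$: $L\leftarrow B_1,\dots,B_m,\lnot B_{m+1},\dots,\lnot B_n$ (the formula $B_1\wedge\dots\wedge\lnot B_n\rightarrow L$), $L,B_i$ literals, $\top$ or $\bot$; $H(r)=L$, $B(r)$ the body; constraint if $H(r)=\bot$. A program is a finite set of formulas $G\rightarrow l$, $l$ a literal, $G$ built from literals, $\top,\bot$ by $\wedge,\vee,\lnot$. $\mathrm{N}_2$ is intuitionistic logic plus Nelson's axioms ($\sim(\alpha\rightarrow\beta)\leftrightarrow\alpha\wedge\sim\beta$, $\sim(\alpha\wedge\beta)\leftrightarrow\sim\alpha\vee\sim\beta$, $\sim(\alpha\vee\beta)\leftrightarrow\sim\alpha\wedge\sim\beta$, $\alpha\leftrightarrow\sim\sim\alpha$,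 $\sim\lnot\alpha\leftrightarrow\alpha$, $\sim a\rightarrow\lnot a$ for atoms) and the schema $\alpha\vee(\alpha\rightarrow\beta)\vee\lnot\beta$. $T\vdash_{N_2}T'$ means $T$ derives every formula of $T'$; $T\equiv_{N_2}T'$ means mutual derivability; $T\equiv_{N_2}\bot$ means $T$ is $\mathrm{N}_2$-inconsistent. A consistent set $M$ of literals over the atoms $\mathcal{A}$ is an answer set of $T$ iff $T\cup\{\lnot l: l\in Lit_{\mathcal{A}}\setminus M\}\cup\{\lnot\lnot l:l\in M\}$ is $\mathrm{N}_2$-consistent and $\mathrm{N}_2$-derives each element of $M$. $P_1\oplus_2P_2$ consists of (i) all constraints of $P_1\cup P_2$; (ii) for each non-constraint $r\in P_1$ with $H(r)=L$, the rule $L\leftarrow B(r),\lnot\sim L$; (iii) all rules of $P_2$. -}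

module Defs where

open import Data.List using (List; []; _∷_; _++_; map)
open import Data.List.Membership.Propositional using (_∈_)
open import Data.List.Relation.Unary.All using (All)
open import Data.Product using (Σ; _×_; _,_)
open import Data.Sum using (_⊎_)
open import Data.Empty using (⊥)
open import Relation.Nullary using (¬_)
open import Relation.Binary.PropositionalEquality using (_≡_)
open import Function.Bundles using (_⇔_)

module Lang (Atom : Set) where

  infixr 6 _∧'_
  infixr 5 _∨'_
  infixr 4 _⇒_
  data Formula : Set where
    atom : Atom → Formula
    ⊥'   : Formula
    _∧'_ : Formula → Formula → Formula
    _∨'_ : Formula → Formula → Formula
    _⇒_  : Formula → Formula → Formula
    ∼_   : Formula → Formula

  ¬'_ : Formula → Formula
  ¬' F = F ⇒ ⊥'

  ⊤' : Formula
  ⊤' = ⊥' ⇒ ⊥'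

  _⇔'_ : Formula → Formula → Formula
  a ⇔' b = (a ⇒ b) ∧' (b ⇒ a)

  data Lit : Set where
    pos : Atom → Lit
    neg : Atom → Lit

  compl : Lit → Lit
  compl (pos a) = neg a
  compl (neg a) = pos a

  litF : Lit → Formula
  litF (pos a) = atom a
  litF (neg a) = ∼ (atom a)

  data Axiom : Formula → Set where
    axK   : ∀ a b → Axiom (a ⇒ (b ⇒ a))
    axS   : ∀ a b c → Axiom ((a ⇒ (b ⇒ c)) ⇒ ((a ⇒ b) ⇒ (a ⇒ c)))
    ax∧I  : ∀ a b → Axiom (a ⇒ (b ⇒ (a ∧' b)))
    ax∧E₁ : ∀ a b → Axiom ((a ∧' b) ⇒ a)
    ax∧E₂ : ∀ a b → Axiom ((a ∧' b) ⇒ b)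
    ax∨I₁ : ∀ a b → Axiom (a ⇒ (a ∨' b))
    ax∨I₂ : ∀ a b → Axiom (b ⇒ (a ∨' b))
    ax∨E  : ∀ a b c → Axiom ((a ⇒ c) ⇒ ((b ⇒ c) ⇒ ((a ∨' b) ⇒ c)))
    ax⊥E  : ∀ a → Axiom (⊥' ⇒ a)
    axN⇒  : ∀ a b → Axiom ((∼ (a ⇒ b)) ⇔' (a ∧' ∼ b))
    axN∧  : ∀ a b → Axiom ((∼ (a ∧' b)) ⇔' (∼ a ∨' ∼ b))
    axN∨  : ∀ a b → Axiom ((∼ (a ∨' b)) ⇔' (∼ a ∧' ∼ b))
    axN∼∼ : ∀ a → Axiom (a ⇔' (∼ (∼ a)))
    axN∼¬ : ∀ a → Axiom ((∼ (¬' a)) ⇔' a)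
    axNat : ∀ p → Axiom ((∼ (atom p)) ⇒ (¬' (atom p)))
    axN₂  : ∀ a b → Axiom (a ∨' ((a ⇒ b) ∨' (¬' b)))

  -- theories are (possibly infinite) sets of formulas, given as predicates
  Theory : Set₁
  Theory = Formula → Set

  infix 2 _⊢_
  data _⊢_ (T : Theory) : Formula → Set where
    hyp : ∀ {φ} → T φ → T ⊢ φ
    ax  : ∀ {φ} → Axiom φ → T ⊢ φ
    mp  : ∀ {φ ψ} → T ⊢ (φ ⇒ ψ) → T ⊢ φ → T ⊢ ψ

  _⊢ₜ_ : Theory → Theory → Set
  T ⊢ₜ T' = ∀ φ → T' φ → T ⊢ φ

  _≡N₂_ : Theory → Theory → Set
  T ≡N₂ T' = (T ⊢ₜ T') × (T' ⊢ₜ T)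

  -- T ≡_{N₂} ⊥  (N₂-inconsistent)
  Inconsistent : Theory → Set
  Inconsistent T = T ⊢ ⊥'

  Consistent : Theory → Set
  Consistent T = ¬ (T ⊢ ⊥')

  _∪ₜ_ : Theory → Theory → Theory
  (T ∪ₜ T') φ = T φ ⊎ T' φ

  data Elem : Set where
    lit : Lit → Elem
    top : Elem
    bot : Elem

  elemF : Elem → Formula
  elemF (lit l) = litF l
  elemF top     = ⊤'
  elemF bot     = ⊥'

  -- ∼L for a head L (only used for non-constraints);
  -- convention ∼⊤ := ⊥ (and ∼⊥ := ⊤)
  complE : Elem → Elem
  complE (lit l) = lit (compl l)
  complE top     = bot
  complE bot     = top

  record Rule : Set where
    constructor _←_∣_
    field
      head    : Elem
      posBody : List Elem
      negBody : List Elem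
  open Rule public

  ELP : Set
  ELP = List Rule

  conj : List Formula → Formula
  conj []           = ⊤'
  conj (x ∷ [])     = x
  conj (x ∷ y ∷ xs) = x ∧' conj (y ∷ xs)

  bodyF : Rule → Formula
  bodyF r = conj (map elemF (posBody r) ++ map (λ b → ¬' elemF b) (negBody r))

  ruleF : Rule → Formula
  ruleF r = bodyF r ⇒ elemF (head r)

  ⟦_⟧ : ELP → Theory
  ⟦ P ⟧ φ = φ ∈ map ruleF P

  upd : Rule → Rule
  upd (bot   ← ps ∣ ns) = bot ← ps ∣ ns
  upd (lit l ← ps ∣ ns) = lit l ← ps ∣ (ns ++ (complE (lit l) ∷ []))
  upd (top   ← ps ∣ ns) = top ← ps ∣ (ns ++ (complE top ∷ []))

  -- P₁ ⊕₂ P₂ = (constraints of P₁ ∪ P₂) ∪ (weakened non-constraints of P₁) ∪ P₂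
  -- (constraints of P₂ are already in P₂)
  _⊕₂_ : ELP → ELP → ELP
  P₁ ⊕₂ P₂ = map upd P₁ ++ P₂

  data IsBodyFormula : Formula → Set where
    gLit : ∀ l → IsBodyFormula (litF l)
    gTop : IsBodyFormula ⊤'
    gBot : IsBodyFormula ⊥'
    gAnd : ∀ {a b} → IsBodyFormula a → IsBodyFormula b → IsBodyFormula (a ∧' b)
    gOr  : ∀ {a b} → IsBodyFormula a → IsBodyFormula b → IsBodyFormula (a ∨' b)
    gNot : ∀ {a} → IsBodyFormula a → IsBodyFormula (¬' a)

  -- heads: a literal (or ⊤/⊥, so that constraints are allowed)
  IsHeadFormula : Formula → Set
  IsHeadFormula φ = Σ Elem (λ e → φ ≡ elemF e)

  IsProgramFormula : Formula → Set
  IsProgramFormula φ =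
    Σ Formula (λ G → Σ Formula (λ l →
      (φ ≡ (G ⇒ l)) × IsBodyFormula G × IsHeadFormula l))

  IsProgram : List Formula → Set
  IsProgram = All IsProgramFormula

  LitSet : Set₁
  LitSet = Lit → Set

  ConsistentLits : LitSet → Set
  ConsistentLits M = ∀ l → M l → ¬ M (compl l)

  completion : Theory → LitSet → Theory
  completion T M φ =
    T φ
    ⊎ Σ Lit (λ l → ¬ M l × φ ≡ ¬' litF l)
    ⊎ Σ Lit (λ l → M l × φ ≡ ¬' (¬' litF l))

  IsAnswerSet : Theory → LitSet → Set
  IsAnswerSet T M =
    ConsistentLits M
    × Consistent (completion T M)
    × (∀ l → M l → completion T M ⊢ litF l)

  SameAnswerSets : Theory → Theory → Set₁
  SameAnswerSets T T' = ∀ (M : LitSet) → IsAnswerSet T M ⇔ IsAnswerSet T' M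

{-# OPTIONS --safe #-}
module Submission where

-- A rule of P₁ enters P₁ ⊕₂ P₂ only with its body strengthened by ¬∼L, so it is N₂-implied
-- by the original rule, while P₂ is kept verbatim. Hence ⊕₂ lies between P₂ and P₁ ∪ P₂ and
-- respects N₂-equivalence in its second argument. Answer sets are invariant under
-- N₂-equivalence, because adding the same formulas ¬l, ¬¬l to equivalent theories yields
-- equivalent theories.

open import Defs
open import Data.List using (List; []; _∷_; _++_; map)
open import Data.List.Properties using (map-++; ++-assoc)
open import Data.List.Membership.Propositional using (_∈_)
open import Data.List.Membership.Propositional.Properties using (∈-map⁺; ∈-map⁻; ∈-++⁺ˡ; ∈-++⁺ʳ; ∈-++⁻)
open import Data.List.Relation.Unary.All using (All; []; _∷_; universal)
open import Data.List.Relation.Unary.All.Properties using (map⁺; ++⁺)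
open import Data.Product using (_×_; _,_; proj₁; proj₂; swap)
open import Data.Sum using (_⊎_; inj₁; inj₂; [_,_])
open import Function using (_∘_)
open import Function.Bundles using (mk⇔)
open import Relation.Binary.PropositionalEquality using (_≡_; refl; sym; cong; subst; module ≡-Reasoning)

module N₂Update (Atom : Set) where
  open Lang Atom

  variable
    T T′ T₁ T₂ T₁′ T₂′ : Theory
    φ ψ χ : Formula
    M : LitSet

  ⊢-cut : T ⊢ₜ T′ → T′ ⊢ φ → T ⊢ φ
  ⊢-cut f (hyp t)  = f _ t
  ⊢-cut f (ax a)   = ax a
  ⊢-cut f (mp d e) = mp (⊢-cut f d) (⊢-cut f e)

  ⊆⇒⊢ₜ : (∀ {φ} → T′ φ → T φ) → T ⊢ₜ T′
  ⊆⇒⊢ₜ T′⊆T _ t = hyp (T′⊆T t)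

  ⊢ₜ-refl : T ⊢ₜ T
  ⊢ₜ-refl = ⊆⇒⊢ₜ (λ t → t)

  ⊢ₜ-trans : T₁ ⊢ₜ T₂ → T₂ ⊢ₜ T → T₁ ⊢ₜ T
  ⊢ₜ-trans f g φ t = ⊢-cut f (g φ t)

  ∪ₜ-mono-⊢ₜ : T₁ ⊢ₜ T₁′ → T₂ ⊢ₜ T₂′ → (T₁ ∪ₜ T₂) ⊢ₜ (T₁′ ∪ₜ T₂′)
  ∪ₜ-mono-⊢ₜ f g φ (inj₁ t) = ⊢-cut (⊆⇒⊢ₜ inj₁) (f φ t)
  ∪ₜ-mono-⊢ₜ f g φ (inj₂ t) = ⊢-cut (⊆⇒⊢ₜ inj₂) (g φ t)

  _▹_ : Theory → Formula → Theory
  (T ▹ φ) ψ = T ψ ⊎ ψ ≡ φ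

  ⇒-refl : ∀ φ → T ⊢ φ ⇒ φ
  ⇒-refl φ = mp (mp (ax (axS φ (φ ⇒ φ) φ)) (ax (axK φ (φ ⇒ φ)))) (ax (axK φ φ))

  ⇒-trans : T ⊢ φ ⇒ ψ → T ⊢ ψ ⇒ χ → T ⊢ φ ⇒ χ
  ⇒-trans {φ = φ} {ψ} {χ} d e = mp (mp (ax (axS φ ψ χ)) (mp (ax (axK (ψ ⇒ χ) φ)) e)) d

  deduction : (T ▹ φ) ⊢ ψ → T ⊢ φ ⇒ ψ
  deduction {φ = φ} (hyp (inj₁ t))    = mp (ax (axK _ φ)) (hyp t)
  deduction {φ = φ} (hyp (inj₂ refl)) = ⇒-refl φ
  deduction {φ = φ} (ax a)            = mp (ax (axK _ φ)) (ax a)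
  deduction {φ = φ} (mp {ψ₁} {ψ₂} d e) = mp (mp (ax (axS φ ψ₁ ψ₂)) (deduction d)) (deduction e)

  ∧-monoʳ : T ⊢ ψ ⇒ χ → T ⊢ (φ ∧' ψ) ⇒ (φ ∧' χ)
  ∧-monoʳ {ψ = ψ} {χ} {φ} d = deduction
    (mp (mp (ax (ax∧I φ χ)) (mp (ax (ax∧E₁ φ ψ)) assumption))
        (mp (⊢-cut (⊆⇒⊢ₜ inj₁) d) (mp (ax (ax∧E₂ φ ψ)) assumption)))
    where
    assumption : (T ▹ (φ ∧' ψ)) ⊢ φ ∧' ψ
    assumption = hyp (inj₂ refl)

  conj-snoc-⇒ : ∀ φs ψ → T ⊢ conj (φs ++ ψ ∷ []) ⇒ conj φs
  conj-snoc-⇒ []            ψ = mp (ax (axK ⊤' ψ)) (⇒-refl ⊥')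
  conj-snoc-⇒ (φ ∷ [])      ψ = ax (ax∧E₁ φ ψ)
  conj-snoc-⇒ (φ ∷ φ′ ∷ φs) ψ = ∧-monoʳ (conj-snoc-⇒ (φ′ ∷ φs) ψ)

  ⊢-addNegBody : ∀ h ps ns c → T ⊢ ruleF (h ← ps ∣ ns) → T ⊢ ruleF (h ← ps ∣ (ns ++ c ∷ []))
  ⊢-addNegBody {T = T} h ps ns c d =
    subst (λ B → T ⊢ B ⇒ elemF h) (sym bodyF-snoc) (⇒-trans (conj-snoc-⇒ body (¬' elemF c)) d)
    where
    open ≡-Reasoning
    body : List Formula
    body = map elemF ps ++ map (¬'_ ∘ elemF) ns

    bodyF-snoc : bodyF (h ← ps ∣ (ns ++ c ∷ [])) ≡ conj (body ++ ¬' elemF c ∷ [])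
    bodyF-snoc = cong conj (begin
      map elemF ps ++ map (¬'_ ∘ elemF) (ns ++ c ∷ [])
        ≡⟨ cong (map elemF ps ++_) (map-++ (¬'_ ∘ elemF) ns (c ∷ [])) ⟩
      map elemF ps ++ (map (¬'_ ∘ elemF) ns ++ ¬' elemF c ∷ [])
        ≡⟨ sym (++-assoc (map elemF ps) _ _) ⟩
      body ++ ¬' elemF c ∷ [] ∎)

  ⊢-upd : ∀ r → T ⊢ ruleF r → T ⊢ ruleF (upd r)
  ⊢-upd (bot   ← ps ∣ ns) d = d
  ⊢-upd (lit l ← ps ∣ ns) d = ⊢-addNegBody (lit l) ps ns (lit (compl l)) d
  ⊢-upd (top   ← ps ∣ ns) d = ⊢-addNegBody top ps ns bot d

  ⟦++⟧⁻ : ∀ P Q → ⟦ P ++ Q ⟧ φ → (⟦ P ⟧ ∪ₜ ⟦ Q ⟧) φ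
  ⟦++⟧⁻ P Q = ∈-++⁻ (map ruleF P) ∘ subst (_ ∈_) (map-++ ruleF P Q)

  ⟦++⟧⁺ : ∀ P Q → (⟦ P ⟧ ∪ₜ ⟦ Q ⟧) φ → ⟦ P ++ Q ⟧ φ
  ⟦++⟧⁺ P Q = subst (_ ∈_) (sym (map-++ ruleF P Q)) ∘ [ ∈-++⁺ˡ , ∈-++⁺ʳ (map ruleF P) ]

  ⟦++⟧≡N₂∪ₜ : ∀ P Q → ⟦ P ++ Q ⟧ ≡N₂ (⟦ P ⟧ ∪ₜ ⟦ Q ⟧)
  ⟦++⟧≡N₂∪ₜ P Q = ⊆⇒⊢ₜ (⟦++⟧⁺ P Q) , ⊆⇒⊢ₜ (⟦++⟧⁻ P Q)

  ++-monoʳ-⊢ₜ : ∀ P {Q Q′} → ⟦ Q ⟧ ⊢ₜ ⟦ Q′ ⟧ → ⟦ P ++ Q ⟧ ⊢ₜ ⟦ P ++ Q′ ⟧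
  ++-monoʳ-⊢ₜ P {Q} {Q′} f =
    ⊢ₜ-trans (proj₁ (⟦++⟧≡N₂∪ₜ P Q)) (⊢ₜ-trans (∪ₜ-mono-⊢ₜ ⊢ₜ-refl f) (proj₂ (⟦++⟧≡N₂∪ₜ P Q′)))

  ⟦⟧-⊢ₜ-map-upd : ∀ P → ⟦ P ⟧ ⊢ₜ ⟦ map upd P ⟧
  ⟦⟧-⊢ₜ-map-upd P φ φ∈ with ∈-map⁻ ruleF φ∈
  ... | r′ , r′∈ , refl with ∈-map⁻ upd r′∈
  ... | r , r∈P , refl = ⊢-upd r (hyp (∈-map⁺ ruleF r∈P))

  ⊕₂-⊢ₜʳ : ∀ P₁ P₂ → ⟦ P₁ ⊕₂ P₂ ⟧ ⊢ₜ ⟦ P₂ ⟧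
  ⊕₂-⊢ₜʳ P₁ P₂ = ⊢ₜ-trans (proj₁ (⟦++⟧≡N₂∪ₜ (map upd P₁) P₂)) (⊆⇒⊢ₜ inj₂)

  ∪ₜ-⊢ₜ-⊕₂ : ∀ P₁ P₂ → (⟦ P₁ ⟧ ∪ₜ ⟦ P₂ ⟧) ⊢ₜ ⟦ P₁ ⊕₂ P₂ ⟧
  ∪ₜ-⊢ₜ-⊕₂ P₁ P₂ =
    ⊢ₜ-trans (∪ₜ-mono-⊢ₜ (⟦⟧-⊢ₜ-map-upd P₁) ⊢ₜ-refl) (proj₂ (⟦++⟧≡N₂∪ₜ (map upd P₁) P₂))

  ⊕₂-congʳ : ∀ P {P₁ P₂} → ⟦ P₁ ⟧ ≡N₂ ⟦ P₂ ⟧ → ⟦ P ⊕₂ P₁ ⟧ ≡N₂ ⟦ P ⊕₂ P₂ ⟧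
  ⊕₂-congʳ P (f , g) = ++-monoʳ-⊢ₜ (map upd P) f , ++-monoʳ-⊢ₜ (map upd P) g

  completion-mono-⊢ₜ : ∀ M → T ⊢ₜ T′ → completion T M ⊢ₜ completion T′ M
  completion-mono-⊢ₜ M f φ (inj₁ t) = ⊢-cut (⊆⇒⊢ₜ inj₁) (f φ t)
  completion-mono-⊢ₜ M f φ (inj₂ t) = hyp (inj₂ t)

  IsAnswerSet-resp-≡N₂ : T ≡N₂ T′ → IsAnswerSet T M → IsAnswerSet T′ M
  IsAnswerSet-resp-≡N₂ {M = M} (f , g) (M-consistent , completion-consistent , M-derived) =
      M-consistent
    , completion-consistent ∘ ⊢-cut (completion-mono-⊢ₜ M f)
    , λ l l∈M → ⊢-cut (completion-mono-⊢ₜ M g) (M-derived l l∈M)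

  ≡N₂⇒SameAnswerSets : T ≡N₂ T′ → SameAnswerSets T T′
  ≡N₂⇒SameAnswerSets e M = mk⇔ (IsAnswerSet-resp-≡N₂ e) (IsAnswerSet-resp-≡N₂ (swap e))

  elemF-isBody : ∀ e → IsBodyFormula (elemF e)
  elemF-isBody (lit l) = gLit l
  elemF-isBody top     = gTop
  elemF-isBody bot     = gBot

  conj-isBody : ∀ {φs} → All IsBodyFormula φs → IsBodyFormula (conj φs)
  conj-isBody []           = gTop
  conj-isBody (p ∷ [])     = p
  conj-isBody (p ∷ q ∷ qs) = gAnd p (conj-isBody (q ∷ qs))

  ruleF-isProgramFormula : ∀ r → IsProgramFormula (ruleF r)
  ruleF-isProgramFormula (h ← ps ∣ ns) = _ , _ , refl , conj-isBody body-isBody , h , refl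
    where
    body-isBody : All IsBodyFormula (map elemF ps ++ map (¬'_ ∘ elemF) ns)
    body-isBody = ++⁺ (map⁺ (universal elemF-isBody ps)) (map⁺ (universal (gNot ∘ elemF-isBody) ns))

  ELP-isProgram : ∀ P → IsProgram (map ruleF P)
  ELP-isProgram P = map⁺ (universal ruleF-isProgramFormula P)

theorem4p5 : (Atom : Set) → let open Lang Atom in
    ((P : ELP) (x : Rule) → IsProgram (map ruleF (P ⊕₂ (x ∷ []))))
    × ((P₁ P₂ : ELP) → ⟦ P₁ ⊕₂ P₂ ⟧ ⊢ₜ ⟦ P₂ ⟧)
    × ((P₁ P₂ : ELP) → (⟦ P₁ ⟧ ∪ₜ ⟦ P₂ ⟧) ⊢ₜ ⟦ P₁ ⊕₂ P₂ ⟧)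
    × ((P₁ P₂ : ELP) → Inconsistent ⟦ P₂ ⟧ → Inconsistent ⟦ P₁ ⊕₂ P₂ ⟧)
    × ((P P₁ P₂ : ELP) → ⟦ P₁ ⟧ ≡N₂ ⟦ P₂ ⟧ → SameAnswerSets ⟦ P ⊕₂ P₁ ⟧ ⟦ P ⊕₂ P₂ ⟧)
theorem4p5 Atom =
    (λ P x → ELP-isProgram (P ⊕₂ (x ∷ [])))
  , ⊕₂-⊢ₜʳ
  , ∪ₜ-⊢ₜ-⊕₂
  , (λ P₁ P₂ → ⊢-cut (⊕₂-⊢ₜʳ P₁ P₂))
  , (λ P P₁ P₂ → ≡N₂⇒SameAnswerSets ∘ ⊕₂-congʳ P)
  where
  open Lang Atom
  open N₂Update Atom
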